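{- Let $\Sigma=(G,\sigma)$ be a signed graph whose underlying graph $G$ is $2$-connected and non-geodetic. Let $u,v$ be an incompatible pair of vertices of $\Sigma$ such that $d(u,v)$ is least among all incompatible pairs of vertices of $\Sigma$. Then there exist two internally disjoint shortest $u$–$v$ paths in $G$ having opposite signs.
   Context: All graphs are simple, finite and connected. A signed graph is $\Sigma=(G,\sigma)$ with $G=(V,E)$ and $\sigma:E\to\{1,-1\}$. The sign of a path $P$ is $\sigma(P)=\prod_{e\in E(P)}\sigma(e)$. For vertices $u,v$, $d(u,v)$ is the usual distance in $G$ and $\mathcal{P}_{(u,v)}$ is the set of all shortest $u$–$v$ paths. Define $d_{\max}(u,v)=\max\{\sigma(P):P\in\mathcal{P}_{(u,v)}\}\,d(u,v)$ and $d_{\min}(u,v)=\min\{\sigma(P):P\in\mathcal{P}_{(u,v)}\}\,d(u,v)$. Vertices $u,v$ are (distance-)compatible if $d_{\min}(u,v)=d_{\max}(u,v)$, and incompatible otherwise. A graph is geodetic if every pair of vertices is joined by a unique shortest path; non-geodetic otherwise. -}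

module Defs where

open import Data.Nat using (ℕ; zero; suc; _≤_)
open import Data.Integer as ℤ using (ℤ; +_; -[1+_])
open import Data.Fin using (Fin)
open import Data.Bool using (Bool; true; false; T)
open import Data.List using (List; []; _∷_)
open import Data.List.Membership.Propositional using (_∈_)
open import Data.List.Relation.Unary.Unique.Propositional using (Unique)
open import Data.Product using (Σ; _×_; _,_; ∃)
open import Data.Sum using (_⊎_)
open import Relation.Binary.PropositionalEquality using (_≡_; _≢_)
open import Relation.Nullary using (¬_)

record Graph : Set where
  field
    n     : ℕ
    adj   : Fin n → Fin n → Bool
    sym   : ∀ u v → adj u v ≡ adj v u
    irrefl : ∀ u → adj u u ≡ false

open Graph public

Adj : (G : Graph) → Fin (n G) → Fin (n G) → Set
Adj G u v = T (adj G u v)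

-- A signed graph: underlying graph plus a signature on edges
-- (true = +1, false = -1).  Values on non-edges are irrelevant.
record SignedGraph : Set where
  field
    graph : Graph
    σ     : Fin (n graph) → Fin (n graph) → Bool
    σ-sym : ∀ u v → σ u v ≡ σ v u

open SignedGraph public

module _ (G : Graph) where

  V : Set
  V = Fin (n G)

  data Walk : V → V → Set where
    stop : (u : V) → Walk u u
    step : (u w : V) {v : V} → Adj G u w → Walk w v → Walk u v

  vertices : ∀ {u v} → Walk u v → List V
  vertices (stop u) = u ∷ []
  vertices (step u w _ p) = u ∷ vertices p

  len : ∀ {u v} → Walk u v → ℕ
  len (stop _) = 0
  len (step _ _ _ p) = suc (len p)

  IsPath : ∀ {u v} → Walk u v → Set
  IsPath p = Unique (vertices p)

  IsShortest : ∀ {u v} → Walk u v → Set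
  IsShortest {u} {v} p = IsPath p × (∀ (q : Walk u v) → IsPath q → len p ≤ len q)

  Dist : V → V → ℕ → Set
  Dist u v k = Σ (Walk u v) λ p → IsShortest p × len p ≡ k

  Connected : Set
  Connected = ∀ (u v : V) → Σ (Walk u v) IsPath

  TwoConnected : Set
  TwoConnected =
    3 ≤ n G × Connected ×
    (∀ (w u v : V) → u ≢ w → v ≢ w →
       Σ (Walk u v) λ p → IsPath p × ¬ (w ∈ vertices p))

  Geodetic : Set
  Geodetic = ∀ (u v : V) (p q : Walk u v) → IsShortest p → IsShortest q →
             vertices p ≡ vertices q

  NonGeodetic : Set
  NonGeodetic = ¬ Geodetic

  InternallyDisjoint : ∀ {u v} → Walk u v → Walk u v → Set
  InternallyDisjoint {u} {v} p q =
    ∀ (w : V) → w ∈ vertices p → w ∈ vertices q → (w ≡ u ⊎ w ≡ v)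

module _ (Σg : SignedGraph) where

  private
    G = graph Σg

  sgn : Bool → ℤ
  sgn true = ℤ.+ 1
  sgn false = ℤ.- (ℤ.+ 1)

  pathSign : ∀ {u v} → Walk G u v → ℤ
  pathSign (stop _) = ℤ.+ 1
  pathSign (step u w _ p) = sgn (σ Σg u w) ℤ.* pathSign p

  signedLen : ∀ {u v} → Walk G u v → ℤ
  signedLen p = pathSign p ℤ.* (ℤ.+ len G p)

  DMax : V G → V G → ℤ → Set
  DMax u v k =
    (Σ (Walk G u v) λ p → IsShortest G p × signedLen p ≡ k) ×
    (∀ (q : Walk G u v) → IsShortest G q → signedLen q ℤ.≤ k)

  DMin : V G → V G → ℤ → Set
  DMin u v k =
    (Σ (Walk G u v) λ p → IsShortest G p × signedLen p ≡ k) ×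
    (∀ (q : Walk G u v) → IsShortest G q → k ℤ.≤ signedLen q)

  Incompatible : V G → V G → Set
  Incompatible u v =
    Σ ℤ λ a → Σ ℤ λ b → DMin u v a × DMax u v b × a ≢ b

-- Let P and Q be shortest u–v paths realising d_min(u,v) and d_max(u,v); since
-- d_min ≠ d_max they have opposite signs. Suppose they share an interior vertex w.
-- Signs are multiplicative under concatenation, so the u–w parts or the w–v parts
-- of P and Q have opposite signs as well; as subpaths of shortest paths they are
-- shortest, so that pair of vertices is incompatible and strictly closer than u, v,
-- contradicting minimality.
module Submission where

open import Defs
open import Data.Nat using (ℕ; _≤_)
open import Data.Integer using (ℤ)
open import Data.Product using (Σ; _×_)
open import Relation.Binary.PropositionalEquality using (_≢_)

open import Data.Nat using (suc; _+_; _<_; s≤s; z≤n)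
open import Data.Nat.Properties as ℕ using (module ≤-Reasoning)
open import Data.Integer as ℤ using (+_; -_; _*_; 1ℤ; -1ℤ)
import Data.Integer.Properties as ℤ
open import Data.Bool using (true; false)
import Data.Fin.Properties as Fin
open import Data.Product using (_,_; proj₁; proj₂)
open import Data.Sum using (_⊎_; inj₁; inj₂)
open import Data.Empty using (⊥; ⊥-elim)
open import Data.List using ([]; _∷_)
open import Data.List.Relation.Unary.Any using (here; there)
import Data.List.Relation.Unary.All as All
open import Data.List.Relation.Unary.All.Properties using (¬Any⇒All¬)
open import Data.List.Relation.Unary.AllPairs using ([]; _∷_)
open import Data.List.Membership.Propositional using (_∈_)
open import Relation.Binary.PropositionalEquality
  using (_≡_; refl; trans; cong; cong₂; subst; module ≡-Reasoning)
import Relation.Binary.PropositionalEquality as ≡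
open import Relation.Nullary using (yes; no)
open import Function using (_∘_)

module _ {G : Graph} where
  open import Data.List.Membership.DecPropositional (Fin._≟_ {n G}) using (_∈?_)

  infixr 5 _++ʷ_

  _++ʷ_ : ∀ {u w v} → Walk G u w → Walk G w v → Walk G u v
  stop _       ++ʷ q = q
  step u x a p ++ʷ q = step u x a (p ++ʷ q)

  len-++ʷ : ∀ {u w v} (p : Walk G u w) (q : Walk G w v) →
            len G (p ++ʷ q) ≡ len G p + len G q
  len-++ʷ (stop _)       q = refl
  len-++ʷ (step _ _ _ p) q = cong suc (len-++ʷ p q)

  len-nonzero : ∀ {u v} (p : Walk G u v) → u ≢ v → 1 ≤ len G p
  len-nonzero (stop _)       u≢u = ⊥-elim (u≢u refl)
  len-nonzero (step _ _ _ _) _   = s≤s z≤n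

  prefix-shorter : ∀ {u w v} (p : Walk G u w) (q : Walk G w v) → w ≢ v →
                   len G p < len G (p ++ʷ q)
  prefix-shorter p q w≢v =
    subst (len G p <_) (≡.sym (len-++ʷ p q)) (ℕ.m<m+n (len G p) (len-nonzero q w≢v))

  suffix-shorter : ∀ {u w v} (p : Walk G u w) (q : Walk G w v) → u ≢ w →
                   len G q < len G (p ++ʷ q)
  suffix-shorter p q u≢w =
    subst (len G q <_) (≡.sym (len-++ʷ p q)) (ℕ.m<n+m (len G q) (len-nonzero p u≢w))

  head∈vertices : ∀ {u v} (p : Walk G u v) → u ∈ vertices G p
  head∈vertices (stop _)       = here refl
  head∈vertices (step _ _ _ _) = here refl

  ∈-vertices-++ʷ⁺ˡ : ∀ {u w v x} (p : Walk G u w) (q : Walk G w v) →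
                     x ∈ vertices G p → x ∈ vertices G (p ++ʷ q)
  ∈-vertices-++ʷ⁺ˡ (stop _)       q (here refl) = head∈vertices q
  ∈-vertices-++ʷ⁺ˡ (step _ _ _ p) q (here refl) = here refl
  ∈-vertices-++ʷ⁺ˡ (step _ _ _ p) q (there x∈p) = there (∈-vertices-++ʷ⁺ˡ p q x∈p)

  splitAt : ∀ {u v w} (p : Walk G u v) → w ∈ vertices G p →
            Σ (Walk G u w) λ p₁ → Σ (Walk G w v) λ p₂ → p ≡ p₁ ++ʷ p₂
  splitAt (stop u)       (here refl) = stop u , stop u , refl
  splitAt (step u x a p) (here refl) = stop u , step u x a p , refl
  splitAt (step u x a p) (there w∈p) with splitAt p w∈p
  ... | p₁ , p₂ , refl = step u x a p₁ , p₂ , refl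

  IsPath-++ʷ⁻ˡ : ∀ {u w v} (p : Walk G u w) (q : Walk G w v) →
                 IsPath G (p ++ʷ q) → IsPath G p
  IsPath-++ʷ⁻ˡ (stop _)       q _ = All.[] ∷ []
  IsPath-++ʷ⁻ˡ (step _ _ _ p) q (u∉rest ∷ pq-path) =
    All.tabulate (λ x∈p → All.lookup u∉rest (∈-vertices-++ʷ⁺ˡ p q x∈p))
      ∷ IsPath-++ʷ⁻ˡ p q pq-path

  IsPath-++ʷ⁻ʳ : ∀ {u w v} (p : Walk G u w) (q : Walk G w v) →
                 IsPath G (p ++ʷ q) → IsPath G q
  IsPath-++ʷ⁻ʳ (stop _)       q pq-path       = pq-path
  IsPath-++ʷ⁻ʳ (step _ _ _ p) q (_ ∷ pq-path) = IsPath-++ʷ⁻ʳ p q pq-path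

  shortcut : ∀ {u v} (p : Walk G u v) →
             Σ (Walk G u v) λ r → IsPath G r × len G r ≤ len G p
  shortcut (stop u) = stop u , All.[] ∷ [] , z≤n
  shortcut (step u x a p) with shortcut p
  ... | r , r-path , r≤p with u ∈? vertices G r
  ...   | no u∉r = step u x a r , ¬Any⇒All¬ _ u∉r ∷ r-path , s≤s r≤p
  ...   | yes u∈r with splitAt r u∈r
  ...     | r₁ , r₂ , refl = r₂ , IsPath-++ʷ⁻ʳ r₁ r₂ r-path , r₂≤p
    where
      open ≤-Reasoning
      r₂≤p : len G r₂ ≤ suc (len G p)
      r₂≤p = begin
        len G r₂                ≤⟨ ℕ.m≤n+m (len G r₂) (len G r₁) ⟩
        len G r₁ + len G r₂     ≡⟨ ≡.sym (len-++ʷ r₁ r₂) ⟩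
        len G (r₁ ++ʷ r₂)       ≤⟨ ℕ.n≤1+n _ ⟩
        suc (len G (r₁ ++ʷ r₂)) ≤⟨ s≤s r≤p ⟩
        suc (len G p)           ∎

  IsShortest⇒len≤walk : ∀ {u v} {p : Walk G u v} → IsShortest G p →
                        (q : Walk G u v) → len G p ≤ len G q
  IsShortest⇒len≤walk (_ , minimal) q =
    let r , r-path , r≤q = shortcut q in ℕ.≤-trans (minimal r r-path) r≤q

  IsShortest⇒len≡ : ∀ {u v} {p q : Walk G u v} →
                    IsShortest G p → IsShortest G q → len G p ≡ len G q
  IsShortest⇒len≡ {p = p} {q} p-short q-short =
    ℕ.≤-antisym (proj₂ p-short q (proj₁ q-short)) (proj₂ q-short p (proj₁ p-short))

  IsShortest-++ʷ⁻ : ∀ {u w v} (p : Walk G u w) (q : Walk G w v) →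
                    IsShortest G (p ++ʷ q) → IsShortest G p × IsShortest G q
  IsShortest-++ʷ⁻ p q pq-short@(pq-path , _) =
      (IsPath-++ʷ⁻ˡ p q pq-path , λ r _ → ℕ.+-cancelʳ-≤ (len G q) _ _ (begin
        len G p + len G q   ≡⟨ ≡.sym (len-++ʷ p q) ⟩
        len G (p ++ʷ q)     ≤⟨ IsShortest⇒len≤walk pq-short (r ++ʷ q) ⟩
        len G (r ++ʷ q)     ≡⟨ len-++ʷ r q ⟩
        len G r + len G q   ∎))
    , (IsPath-++ʷ⁻ʳ p q pq-path , λ r _ → ℕ.+-cancelˡ-≤ (len G p) _ _ (begin
        len G p + len G q   ≡⟨ ≡.sym (len-++ʷ p q) ⟩
        len G (p ++ʷ q)     ≤⟨ IsShortest⇒len≤walk pq-short (p ++ʷ r) ⟩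
        len G (p ++ʷ r)     ≡⟨ len-++ʷ p r ⟩
        len G p + len G r   ∎))
    where open ≤-Reasoning

IsUnit : ℤ → Set
IsUnit i = i ≡ 1ℤ ⊎ i ≡ -1ℤ

IsUnit-* : ∀ {i j} → IsUnit i → IsUnit j → IsUnit (i * j)
IsUnit-* (inj₁ refl) (inj₁ refl) = inj₁ refl
IsUnit-* (inj₁ refl) (inj₂ refl) = inj₂ refl
IsUnit-* (inj₂ refl) (inj₁ refl) = inj₂ refl
IsUnit-* (inj₂ refl) (inj₂ refl) = inj₁ refl

IsUnit-≢⇒opposite : ∀ {i j} → IsUnit i → IsUnit j → i ≢ j →
                    (i ≡ 1ℤ × j ≡ -1ℤ) ⊎ (i ≡ -1ℤ × j ≡ 1ℤ)
IsUnit-≢⇒opposite (inj₁ refl) (inj₁ refl) i≢j = ⊥-elim (i≢j refl)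
IsUnit-≢⇒opposite (inj₁ refl) (inj₂ refl) _   = inj₁ (refl , refl)
IsUnit-≢⇒opposite (inj₂ refl) (inj₁ refl) _   = inj₂ (refl , refl)
IsUnit-≢⇒opposite (inj₂ refl) (inj₂ refl) i≢j = ⊥-elim (i≢j refl)

module _ (S : SignedGraph) where
  private
    G : Graph
    G = graph S

  OppositeShortestPaths : V G → V G → Set
  OppositeShortestPaths x y =
    Σ (Walk G x y) λ p → Σ (Walk G x y) λ q →
      IsShortest G p × IsShortest G q × pathSign S p ≢ pathSign S q

  pathSign-++ʷ : ∀ {u w v} (p : Walk G u w) (q : Walk G w v) →
                 pathSign S (p ++ʷ q) ≡ pathSign S p * pathSign S q
  pathSign-++ʷ (stop _)       q = ≡.sym (ℤ.*-identityˡ _)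
  pathSign-++ʷ (step u x _ p) q = trans (cong (sgn S (σ S u x) *_) (pathSign-++ʷ p q))
                                        (≡.sym (ℤ.*-assoc (sgn S (σ S u x)) _ _))

  pathSign-++ʷ-≢ : ∀ {u w v} (p₁ q₁ : Walk G u w) (p₂ q₂ : Walk G w v) →
                   pathSign S (p₁ ++ʷ p₂) ≢ pathSign S (q₁ ++ʷ q₂) →
                   pathSign S p₁ ≢ pathSign S q₁ ⊎ pathSign S p₂ ≢ pathSign S q₂
  pathSign-++ʷ-≢ p₁ q₁ p₂ q₂ p≢q with pathSign S p₁ ℤ.≟ pathSign S q₁
  ... | no p₁≢q₁ = inj₁ p₁≢q₁
  ... | yes p₁≡q₁ = inj₂ λ p₂≡q₂ → p≢q (begin
    pathSign S (p₁ ++ʷ p₂)        ≡⟨ pathSign-++ʷ p₁ p₂ ⟩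
    pathSign S p₁ * pathSign S p₂ ≡⟨ cong₂ _*_ p₁≡q₁ p₂≡q₂ ⟩
    pathSign S q₁ * pathSign S q₂ ≡⟨ ≡.sym (pathSign-++ʷ q₁ q₂) ⟩
    pathSign S (q₁ ++ʷ q₂)        ∎)
    where open ≡-Reasoning

  pathSign-IsUnit : ∀ {u v} (p : Walk G u v) → IsUnit (pathSign S p)
  pathSign-IsUnit (stop _)       = inj₁ refl
  pathSign-IsUnit (step u x _ p) = IsUnit-* (sgn-IsUnit (σ S u x)) (pathSign-IsUnit p)
    where
      sgn-IsUnit : ∀ b → IsUnit (sgn S b)
      sgn-IsUnit true  = inj₁ refl
      sgn-IsUnit false = inj₂ refl

  negative⇒len-nonzero : ∀ {u v} (p : Walk G u v) → pathSign S p ≡ -1ℤ → 1 ≤ len G p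
  negative⇒len-nonzero (stop _)       ()
  negative⇒len-nonzero (step _ _ _ _) _ = s≤s z≤n

  signedLen-positive : ∀ {u v} (p : Walk G u v) → pathSign S p ≡ 1ℤ →
                       signedLen S p ≡ + len G p
  signedLen-positive p p≡1 = trans (cong (_* + len G p) p≡1) (ℤ.*-identityˡ _)

  signedLen-negative : ∀ {u v} (p : Walk G u v) → pathSign S p ≡ -1ℤ →
                       signedLen S p ≡ - + len G p
  signedLen-negative p p≡-1 = trans (cong (_* + len G p) p≡-1) (ℤ.-1*i≡-i _)

  -len≤signedLen : ∀ {u v} (p : Walk G u v) → - + len G p ℤ.≤ signedLen S p
  -len≤signedLen p with pathSign-IsUnit p
  ... | inj₁ p≡1  = ℤ.≤-trans ℤ.neg-≤-pos (ℤ.≤-reflexive (≡.sym (signedLen-positive p p≡1)))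
  ... | inj₂ p≡-1 = ℤ.≤-reflexive (≡.sym (signedLen-negative p p≡-1))

  signedLen≤len : ∀ {u v} (p : Walk G u v) → signedLen S p ℤ.≤ + len G p
  signedLen≤len p with pathSign-IsUnit p
  ... | inj₁ p≡1  = ℤ.≤-reflexive (signedLen-positive p p≡1)
  ... | inj₂ p≡-1 = ℤ.≤-trans (ℤ.≤-reflexive (signedLen-negative p p≡-1)) ℤ.neg-≤-pos

  -- Both d_min = -d and d_max = d are attained, and they differ because d > 0.
  positive-negative⇒Incompatible :
    ∀ {x y} {p q : Walk G x y} → IsShortest G p → IsShortest G q →
    pathSign S p ≡ 1ℤ → pathSign S q ≡ -1ℤ → Incompatible S x y
  positive-negative⇒Incompatible {p = p} {q} p-short q-short p≡1 q≡-1 =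
      - + d , + d
    , ((q , q-short , signedLen-negative q q≡-1) , d-min)
    , ((p , p-short , trans (signedLen-positive p p≡1) (cong +_ len-p≡len-q)) , d-max)
    , -d≢d (negative⇒len-nonzero q q≡-1)
    where
      d : ℕ
      d = len G q

      len-p≡len-q : len G p ≡ len G q
      len-p≡len-q = IsShortest⇒len≡ p-short q-short

      d-min : ∀ r → IsShortest G r → - + d ℤ.≤ signedLen S r
      d-min r r-short
        rewrite IsShortest⇒len≡ q-short r-short = -len≤signedLen r

      d-max : ∀ r → IsShortest G r → signedLen S r ℤ.≤ + d
      d-max r r-short
        rewrite IsShortest⇒len≡ q-short r-short = signedLen≤len r

      -d≢d : ∀ {k} → 1 ≤ k → - + k ≢ + k
      -d≢d (s≤s _) ()

  OppositeShortestPaths⇒Incompatible : ∀ {x y} → OppositeShortestPaths x y → Incompatible S x y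
  OppositeShortestPaths⇒Incompatible (p , q , p-short , q-short , p≢q)
    with IsUnit-≢⇒opposite (pathSign-IsUnit p) (pathSign-IsUnit q) p≢q
  ... | inj₁ (p≡1 , q≡-1) = positive-negative⇒Incompatible p-short q-short p≡1 q≡-1
  ... | inj₂ (p≡-1 , q≡1) = positive-negative⇒Incompatible q-short p-short q≡1 p≡-1

  Incompatible⇒OppositeShortestPaths : ∀ {x y} → Incompatible S x y → OppositeShortestPaths x y
  Incompatible⇒OppositeShortestPaths
    (_ , _ , ((p , p-short , refl) , _) , ((q , q-short , refl) , _) , a≢b) =
    p , q , p-short , q-short , λ p≡q →
      a≢b (cong₂ (λ s k → s * + k) p≡q (IsShortest⇒len≡ p-short q-short))

  OppositeShortestPaths-split :
    ∀ {u w v} (p₁ q₁ : Walk G u w) (p₂ q₂ : Walk G w v) →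
    IsShortest G (p₁ ++ʷ p₂) → IsShortest G (q₁ ++ʷ q₂) →
    pathSign S (p₁ ++ʷ p₂) ≢ pathSign S (q₁ ++ʷ q₂) →
    (IsShortest G p₁ × OppositeShortestPaths u w) ⊎
    (IsShortest G p₂ × OppositeShortestPaths w v)
  OppositeShortestPaths-split p₁ q₁ p₂ q₂ p-short q-short p≢q
    with IsShortest-++ʷ⁻ p₁ p₂ p-short | IsShortest-++ʷ⁻ q₁ q₂ q-short
       | pathSign-++ʷ-≢ p₁ q₁ p₂ q₂ p≢q
  ... | p₁-short , _ | q₁-short , _ | inj₁ p₁≢q₁ =
    inj₁ (p₁-short , p₁ , q₁ , p₁-short , q₁-short , p₁≢q₁)
  ... | _ , p₂-short | _ , q₂-short | inj₂ p₂≢q₂ =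
    inj₂ (p₂-short , p₂ , q₂ , p₂-short , q₂-short , p₂≢q₂)

mainTheorem1 : (S : SignedGraph) →
    TwoConnected (graph S) → NonGeodetic (graph S) →
    (u v : V (graph S)) → Incompatible S u v →
    (∀ (x y : V (graph S)) → Incompatible S x y →
       ∀ (d d′ : ℕ) → Dist (graph S) u v d → Dist (graph S) x y d′ → d ≤ d′) →
    Σ (Walk (graph S) u v) λ p → Σ (Walk (graph S) u v) λ q →
      IsShortest (graph S) p × IsShortest (graph S) q ×
      InternallyDisjoint (graph S) p q × pathSign S p ≢ pathSign S q
mainTheorem1 S _ _ u v u~v minimal with Incompatible⇒OppositeShortestPaths S u~v
... | p , q , p-short , q-short , p≢q = p , q , p-short , q-short , disjoint , p≢q
  where
    G : Graph
    G = graph S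

    no-closer-opposite : ∀ {x y} {r : Walk G x y} → IsShortest G r → len G r < len G p →
                         OppositeShortestPaths S x y → ⊥
    no-closer-opposite {x} {y} {r} r-short r<p opp =
      ℕ.<⇒≱ r<p (minimal x y (OppositeShortestPaths⇒Incompatible S opp) _ _
                   (p , p-short , refl) (r , r-short , refl))

    disjoint : InternallyDisjoint G p q
    disjoint w w∈p w∈q with w Fin.≟ u | w Fin.≟ v
    ... | yes w≡u | _       = inj₁ w≡u
    ... | no _    | yes w≡v = inj₂ w≡v
    ... | no w≢u  | no w≢v  with splitAt p w∈p | splitAt q w∈q
    ...   | p₁ , p₂ , refl | q₁ , q₂ , refl
      with OppositeShortestPaths-split S p₁ q₁ p₂ q₂ p-short q-short p≢q
    ...     | inj₁ (p₁-short , opp) =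
      ⊥-elim (no-closer-opposite p₁-short (prefix-shorter p₁ p₂ w≢v) opp)
    ...     | inj₂ (p₂-short , opp) =
      ⊥-elim (no-closer-opposite p₂-short (suffix-shorter p₁ p₂ (w≢u ∘ ≡.sym)) opp)
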